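{- Let $\langle S,\phi\rangle$ be a reduced closure system without $D$-cycles. Let $\Sigma_E$ be the union of the two sets of implications $\{y\rightarrow x: y\in S,\ x\in\phi(y)\setminus\{y\}\}$ and $\{X\rightarrow x: x\in S,\ X\in M^*(x)\}$. Then (a) $\Sigma_E$ is a basis of $\langle S,\phi\rangle$; (b) $\Sigma_E$ is ordered direct, i.e. there is a linear ordering of $\Sigma_E$ with $\rho_{\Sigma_E}(X)=\phi(X)$ for all $X\subseteq S$; (c) the aggregated form of $\Sigma_E$ is ordered direct.
   Context: A closure system is a pair $\langle S,\phi\rangle$ with $S$ a finite nonempty set and $\phi$ a closure operator on $2^S$; it is reduced if $\phi(\{i\})=\phi(\{j\})$ implies $i=j$. Write $\phi(y)$ for $\phi(\{y\})$. For $X,Y\subseteq S$, $X\ll Y$ means every $x\in X$ lies in $\phi(y)$ for some $y\in Y$. $X$ is a cover of $x$ if $x\in\phi(X)\setminus\bigcup_{x'\in X}\phi(x')$; a cover $Y$ of $x$ is minimal if for every cover $Z$ of $x$, $Z\ll Y$ implies $Y\subseteq Z$. $M(x)$ is the set of minimal covers of $x$, and $M^*(x)=\{Y\in M(x): \phi(Y)\text{ is minimal under inclusion in }\{\phi(Z):Z\in M(x)\}\}$. Write $xDy$ if $y\in Y$ for some $Y\in M(x)$. A $D$-cycle is a sequence $x_1,\dots,x_n$, $n>1$, with $x_1Dx_2D\cdots Dx_nDx_1$; the system is without $D$-cycles if it has none. A set of implications is a basis of $\langle S,\phi\rangle$ if $\phi(X)$ is, for every $X$, the smallest superset of $X$ respecting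 all implications ($Z$ respects $A\rightarrow B$ if $A\subseteq Z$ implies $B\subseteq Z$). The aggregated form replaces all implications with a common premise $A$ by one implication $A\rightarrow B$, $B$ the union of their conclusions. For a linearly ordered set of implications $A_1\rightarrow B_1,\dots,A_n\rightarrow B_n$, the ordered iteration is $X_0=X$, $X_k=X_{k-1}\cup B_k$ if $A_k\subseteq X_{k-1}$, else $X_k=X_{k-1}$, and $\rho(X)=X_n$; a set of implications is ordered direct if some linear ordering gives $\rho(X)=\phi(X)$ for all $X$. -}

module Defs where

open import Data.Nat using (ℕ; suc)
open import Data.Fin using (Fin; zero; suc; inject₁; fromℕ)
open import Data.Fin.Subset using (Subset; _∈_; _∉_; _⊆_; _∪_; ⁅_⁆)
open import Data.Fin.Subset.Properties using (_⊆?_)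
open import Data.Product using (Σ; ∃; _×_; _,_; proj₁; proj₂)
open import Data.Sum using (_⊎_)
open import Data.List using (List; foldl)
open import Data.List.Relation.Unary.Unique.Propositional using (Unique)
import Data.List.Membership.Propositional as LM
open import Relation.Nullary using (¬_; yes; no)
open import Relation.Binary.PropositionalEquality using (_≡_; _≢_)
open import Function.Bundles using (_⇔_)

record IsClosureOperator {n : ℕ} (φ : Subset n → Subset n) : Set where
  field
    extensive  : ∀ X → X ⊆ φ X
    monotone   : ∀ {X Y} → X ⊆ Y → φ X ⊆ φ Y
    idempotent : ∀ X → φ (φ X) ≡ φ X

module _ {n : ℕ} (φ : Subset n → Subset n) where

  Reduced : Set
  Reduced = ∀ i j → φ ⁅ i ⁆ ≡ φ ⁅ j ⁆ → i ≡ j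

  _≪_ : Subset n → Subset n → Set
  X ≪ Y = ∀ x → x ∈ X → ∃ λ y → y ∈ Y × x ∈ φ ⁅ y ⁆

  IsCover : Subset n → Fin n → Set
  IsCover X x = x ∈ φ X × (∀ x' → x' ∈ X → x ∉ φ ⁅ x' ⁆)

  MinCover : Fin n → Subset n → Set
  MinCover x Y = IsCover Y x × (∀ Z → IsCover Z x → Z ≪ Y → Y ⊆ Z)

  MinCover* : Fin n → Subset n → Set
  MinCover* x Y = MinCover x Y × (∀ Z → MinCover x Z → φ Z ⊆ φ Y → φ Y ⊆ φ Z)

  D : Fin n → Fin n → Set
  D x y = ∃ λ Y → MinCover x Y × y ∈ Y

  -- a D-cycle x₀ D x₁ D ⋯ D x_{k+1} D x₀ (length k+2 > 1)
  DCycle : Set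
  DCycle = Σ ℕ λ k → Σ (Fin (suc (suc k)) → Fin n) λ xs →
             (∀ (i : Fin (suc k)) → D (xs (inject₁ i)) (xs (suc i)))
           × D (xs (fromℕ (suc k))) (xs zero)

  WithoutDCycles : Set
  WithoutDCycles = ¬ DCycle

Implication : ℕ → Set
Implication n = Subset n × Subset n

ImplicationSet : ℕ → Set₁
ImplicationSet n = Implication n → Set

Respects : ∀ {n} → Subset n → Implication n → Set
Respects Z (A , B) = A ⊆ Z → B ⊆ Z

module _ {n : ℕ} (φ : Subset n → Subset n) where

  IsBasis : ImplicationSet n → Set
  IsBasis Σ' = ∀ X →
      X ⊆ φ X
    × (∀ imp → Σ' imp → Respects (φ X) imp)
    × (∀ Z → X ⊆ Z → (∀ imp → Σ' imp → Respects Z imp) → φ X ⊆ Z)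

  SigmaE : ImplicationSet n
  SigmaE (A , B) =
      (∃ λ y → ∃ λ x → A ≡ ⁅ y ⁆ × B ≡ ⁅ x ⁆ × x ∈ φ ⁅ y ⁆ × x ≢ y)
    ⊎ (∃ λ x → B ≡ ⁅ x ⁆ × MinCover* φ x A)

step : ∀ {n} → Subset n → Implication n → Subset n
step Y (A , B) with A ⊆? Y
... | yes _ = Y ∪ B
... | no  _ = Y

ρ : ∀ {n} → List (Implication n) → Subset n → Subset n
ρ L X = foldl step X L

IsLinearOrdering : ∀ {n} → ImplicationSet n → List (Implication n) → Set
IsLinearOrdering Σ' L = Unique L × (∀ imp → (imp LM.∈ L) ⇔ Σ' imp)

OrderedDirect : ∀ {n} → (Subset n → Subset n) → ImplicationSet n → Set
OrderedDirect φ Σ' = Σ (List _) λ L → IsLinearOrdering Σ' L × (∀ X → ρ L X ≡ φ X)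

Aggregated : ∀ {n} → ImplicationSet n → ImplicationSet n
Aggregated Σ' (A , B) = (∃ λ B' → Σ' (A , B'))
                      × (∀ i → i ∈ B ⇔ (∃ λ B' → Σ' (A , B') × i ∈ B'))

-- The relation D of a reduced closure system without D-cycles is well-founded, so every point x
-- has a height H x with H y < H x whenever x D y.  List Σ_E with the implications y → x first and
-- then each X → x (X ∈ M*(x)) by the largest height of a point of X.  One pass of this list
-- computes φ(Z): a point x ∈ φ(Z) either lies in some φ(y), y ∈ Z, and is produced by the first
-- block, or Z covers x.  In the latter case x has a cover Y ∈ M*(x) inside φ(Z); its points are
-- D-successors of x, hence by induction on the height already produced when Y → x is reached.
-- Such a Y exists by two descents: along (|⋃_{y∈Y} φ(y)|, |Y|) lexicographically to a minimal
-- cover, where reducedness is used, and then along φ(Y) ⊂ to an element of M*(x).  The same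
-- argument applies verbatim to the aggregated form, and soundness turns direct into basis.

module Submission where

open import Data.Bool using (false; true)
open import Data.Bool.Properties using () renaming (_≟_ to _≟ᵇ_)
open import Data.Empty using (⊥-elim)
open import Data.Fin using (Fin; zero; suc; inject₁; fromℕ) renaming (_≟_ to _≟ᶠ_)
open import Data.Fin.Induction using (spo-noetherian)
open import Data.Fin.Properties using (any?; all?)
open import Data.Fin.Subset using (Subset; inside; outside; _∈_; _∉_; _⊆_; _⊂_; _-_; ⁅_⁆; ∣_∣)
open import Data.Fin.Subset.Induction using (⊂-wellFounded)
open import Data.Fin.Subset.Properties
  using ( _∈?_; _⊆?_; _⊂?_; anySubset?; x∈⁅x⁆; x∈⁅y⁆⇒x≡y; ⊆-trans; ⊆-antisym
        ; p⊆p∪q; q⊆p∪q; x∈p∪q⁻; p─q⊆p; x∈p∧x≢y⇒x∈p-y; x∈p⇒∣p-x∣<∣p∣; p⊂q⇒∣p∣<∣q∣)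
open import Data.List
  using (List; []; _∷_; _++_; filter; tabulate; cartesianProduct; cartesianProductWith)
open import Data.List.Extrema.Nat using (max; xs≤max; max≤v⁺)
open import Data.List.Membership.Propositional using () renaming (_∈_ to _∈ₗ_)
open import Data.List.Membership.Propositional.Properties
  using ( ∈-tabulate⁺; ∈-cartesianProductWith⁺; ∈-cartesianProduct⁺; ∈-filter⁺; ∈-filter⁻
        ; ∈-++⁺ˡ; ∈-++⁺ʳ; ∈-++⁻)
open import Data.List.Properties using (foldl-++; tabulate-cong)
open import Data.List.Relation.Unary.All as All using ()
open import Data.List.Relation.Unary.All.Properties using (tabulate⁺)
open import Data.List.Relation.Unary.Any using (here; there)
import Data.List.Relation.Unary.AllPairs as AllPairs
open import Data.List.Relation.Unary.Unique.Propositional using (Unique)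
import Data.List.Relation.Unary.Unique.Propositional.Properties as Unique
open import Data.Nat using (ℕ; zero; suc; _+_; _≤_; _<_; _<?_; _≤′_; z≤n; s≤s; ≤′-refl; ≤′-step)
open import Data.Nat.Induction using (<-wellFounded)
open import Data.Nat.Properties
  using (_≟_; ≤-refl; ≤-reflexive; ≤-trans; <-irrefl; m≤n⇒m≤1+n; ≤∧≢⇒<; ≤-pred; ≤⇒≤′)
open import Data.Product using (Σ; ∃; _×_; _,_; proj₁; proj₂; uncurry)
open import Data.Product.Relation.Binary.Lex.Strict using (×-Lex; ×-wellFounded; ×-decidable)
open import Data.Sum using (inj₁; inj₂; [_,_]′)
open import Data.Vec using () renaming ([] to []ᵛ; _∷_ to _∷ᵛ_; tabulate to tabulateᵛ)
open import Data.Vec.Properties using (≡-dec; ∷-injective; lookup∘tabulate; []=⇒lookup; lookup⇒[]=)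
open import Function using (_∘_)
open import Function.Bundles using (_⇔_; mk⇔; Equivalence)
open import Induction.WellFounded using (WellFounded; Acc; acc; module Subrelation)
open import Level using (Level)
open import Relation.Binary using (Rel; Reflexive; Transitive; IsStrictPartialOrder)
import Relation.Binary.Construct.On as On
open import Relation.Binary.Construct.Closure.Transitive using (TransClosure; [_]; _∷_; transitive)
open import Relation.Binary.PropositionalEquality
  using (_≡_; _≢_; refl; sym; trans; cong; subst; isEquivalence; resp₂)
open import Relation.Nullary using (¬_; Dec; yes; no; does)
open import Relation.Nullary.Decidable
  using (_×-dec_; _⊎-dec_; _→-dec_; ¬?; map′; decidable-stable; dec-true)
open import Relation.Unary using (Pred; Decidable)

open import Defs

private
  variable
    a ℓ ℓ₁ ℓ₂ : Level
    A : Set a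
    n : ℕ

_≟ˢ_ : (X Y : Subset n) → Dec (X ≡ Y)
_≟ˢ_ = ≡-dec _≟ᵇ_

allSubsets : ∀ n → List (Subset n)
allSubsets zero    = []ᵛ ∷ []
allSubsets (suc n) = cartesianProductWith _∷ᵛ_ (outside ∷ inside ∷ []) (allSubsets n)

∈-allSubsets : (X : Subset n) → X ∈ₗ allSubsets n
∈-allSubsets []ᵛ       = here refl
∈-allSubsets (s ∷ᵛ X) =
  ∈-cartesianProductWith⁺ _∷ᵛ_ {xs = outside ∷ inside ∷ []} (∈-sides s) (∈-allSubsets X)
  where
  ∈-sides : ∀ s → s ∈ₗ outside ∷ inside ∷ []
  ∈-sides false = here refl
  ∈-sides true  = there (here refl)

allSubsets-unique : ∀ n → Unique (allSubsets n)
allSubsets-unique zero    = All.[] AllPairs.∷ AllPairs.[]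
allSubsets-unique (suc n) = Unique.cartesianProductWith⁺ _∷ᵛ_ ∷-injective
  (((λ ()) All.∷ All.[]) AllPairs.∷ All.[] AllPairs.∷ AllPairs.[]) (allSubsets-unique n)

allImplications : ∀ n → List (Implication n)
allImplications n = cartesianProduct (allSubsets n) (allSubsets n)

∈-allImplications : (imp : Implication n) → imp ∈ₗ allImplications n
∈-allImplications (A , B) = ∈-cartesianProduct⁺ (∈-allSubsets A) (∈-allSubsets B)

allImplications-unique : ∀ n → Unique (allImplications n)
allImplications-unique n = Unique.cartesianProduct⁺ (allSubsets-unique n) (allSubsets-unique n)

⇔-dec : {P Q : Set ℓ} → Dec P → Dec Q → Dec (P ⇔ Q)
⇔-dec P? Q? =
  map′ (uncurry mk⇔) (λ P⇔Q → Equivalence.to P⇔Q , Equivalence.from P⇔Q)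
       ((P? →-dec Q?) ×-dec (Q? →-dec P?))

∀-subset? : {P : Pred (Subset n) ℓ} → Decidable P → Dec (∀ X → P X)
∀-subset? P? with anySubset? (¬? ∘ P?)
... | yes (X , ¬PX) = no λ ∀P → ¬PX (∀P X)
... | no ¬∃¬P       = yes λ X → decidable-stable (P? X) (λ ¬PX → ¬∃¬P (X , ¬PX))

fromDec : {P : Pred (Fin n) ℓ} → Decidable P → Subset n
fromDec P? = tabulateᵛ (does ∘ P?)

∈-fromDec⁺ : {P : Pred (Fin n) ℓ} (P? : Decidable P) {x : Fin n} → P x → x ∈ fromDec P?
∈-fromDec⁺ P? {x} px = lookup⇒[]= x _ (trans (lookup∘tabulate _ x) (dec-true (P? x) px))

∈-fromDec⁻ : {P : Pred (Fin n) ℓ} (P? : Decidable P) {x : Fin n} → x ∈ fromDec P? → P x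
∈-fromDec⁻ P? {x} x∈ with P? x | trans (sym (lookup∘tabulate _ x)) ([]=⇒lookup x∈)
... | yes px | _  = px
... | no _   | ()

x∈p⇒⁅x⁆⊆p : {x : Fin n} {p : Subset n} → x ∈ p → ⁅ x ⁆ ⊆ p
x∈p⇒⁅x⁆⊆p {x = x} x∈p y∈⁅x⁆ = subst (_∈ _) (sym (x∈⁅y⁆⇒x≡y x y∈⁅x⁆)) x∈p

maxᶠ : (Fin n → ℕ) → ℕ
maxᶠ f = max 0 (tabulate f)

≤-maxᶠ : (f : Fin n → ℕ) (i : Fin n) → f i ≤ maxᶠ f
≤-maxᶠ f i = All.lookup (xs≤max 0 (tabulate f)) (∈-tabulate⁺ i)

maxᶠ-≤ : {f : Fin n → ℕ} {c : ℕ} → (∀ i → f i ≤ c) → maxᶠ f ≤ c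
maxᶠ-≤ f≤c = max≤v⁺ z≤n (tabulate⁺ f≤c)

maxᶠ-cong : {f g : Fin n → ℕ} → (∀ i → f i ≡ g i) → maxᶠ f ≡ maxᶠ g
maxᶠ-cong f≗g = cong (max 0) (tabulate-cong f≗g)

onYes : {P : Set ℓ} → Dec P → (P → ℕ) → ℕ
onYes (yes p) f = f p
onYes (no _)  _ = 0

onYes-cong : {P : Set ℓ} (P? : Dec P) {f g : P → ℕ} → (∀ p → f p ≡ g p) → onYes P? f ≡ onYes P? g
onYes-cong (yes p) f≗g = f≗g p
onYes-cong (no _)  _   = refl

≤-onYes : {P : Set ℓ} (P? : Dec P) {f : P → ℕ} {c : ℕ} → P → (∀ p → c ≤ f p) → c ≤ onYes P? f
≤-onYes (yes p) _ c≤f = c≤f p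
≤-onYes (no ¬p) p _   = ⊥-elim (¬p p)

onYes-≤ : {P : Set ℓ} (P? : Dec P) {f : P → ℕ} {c : ℕ} → (∀ p → f p ≤ c) → onYes P? f ≤ c
onYes-≤ (yes p) f≤c = f≤c p
onYes-≤ (no _)  _   = z≤n

-- Well-founded descent

module Descent {A : Set a} (_⊏_ : Rel A ℓ₁) (_≼_ : Rel A ℓ₂) (P : Pred A ℓ) where

  Improvable : Pred A _
  Improvable Y = ∃ λ Z → P Z × Z ≼ Y × Z ⊏ Y

  descend : WellFounded _⊏_ → Reflexive _≼_ → Transitive _≼_ → Decidable Improvable →
            ∀ {Y} → P Y → ∃ λ Z → P Z × Z ≼ Y × ¬ Improvable Z
  descend wf ≼-refl ≼-trans improvable? {Y} = go (wf Y)
    where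
    go : ∀ {Y} → Acc _⊏_ Y → P Y → ∃ λ Z → P Z × Z ≼ Y × ¬ Improvable Z
    go {Y} (acc rs) PY with improvable? Y
    ... | no unimprovable = Y , PY , ≼-refl , unimprovable
    ... | yes (Z , PZ , Z≼Y , Z⊏Y) with go (rs Z⊏Y) PZ
    ...   | W , PW , W≼Z , unimprovable = W , PW , ≼-trans W≼Z Z≼Y , unimprovable

Walk : Rel A ℓ → ℕ → A → A → Set _
Walk {A = A} R m a b = Σ (Fin (suc (suc m)) → A) λ xs →
  xs zero ≡ a × xs (fromℕ (suc m)) ≡ b × (∀ i → R (xs (inject₁ i)) (xs (suc i)))

TransClosure⇒Walk : {R : Rel A ℓ} {a b : A} → TransClosure R a b → ∃ λ m → Walk R m a b
TransClosure⇒Walk {A = A} {R = R} {a} {b} [ aRb ] = 0 , xs , refl , refl , λ { zero → aRb }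
  where
  xs : Fin 2 → A
  xs zero    = a
  xs (suc _) = b
TransClosure⇒Walk {A = A} {R = R} {a} (aRy ∷ y⁺b) with TransClosure⇒Walk y⁺b
... | m , xs , xs₀≡y , xsₘ≡b , steps = suc m , ys , refl , xsₘ≡b , ys-steps
  where
  ys : Fin (suc (suc (suc m))) → A
  ys zero    = a
  ys (suc i) = xs i
  ys-steps : ∀ i → R (ys (inject₁ i)) (ys (suc i))
  ys-steps zero    = subst (R a) (sym xs₀≡y) aRy
  ys-steps (suc i) = steps i

-- Ordered iteration

step-extensive : (Y : Subset n) (imp : Implication n) → Y ⊆ step Y imp
step-extensive Y (A , B) with A ⊆? Y
... | yes _ = p⊆p∪q B
... | no _  = λ x∈ → x∈

step-fires : {Y A B : Subset n} → A ⊆ Y → B ⊆ step Y (A , B)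
step-fires {Y = Y} {A} {B} A⊆Y with A ⊆? Y
... | yes _  = q⊆p∪q Y B
... | no A⊈Y = ⊥-elim (A⊈Y A⊆Y)

step-sound : {Y Z : Subset n} (imp : Implication n) → Y ⊆ Z → Respects Z imp → step Y imp ⊆ Z
step-sound {Y = Y} (A , B) Y⊆Z resp with A ⊆? Y
... | yes A⊆Y = [ Y⊆Z , resp (⊆-trans A⊆Y Y⊆Z) ]′ ∘ x∈p∪q⁻ Y B
... | no _    = Y⊆Z

ρ-extensive : (L : List (Implication n)) (Y : Subset n) → Y ⊆ ρ L Y
ρ-extensive []      Y = λ x∈ → x∈
ρ-extensive (i ∷ L) Y = ⊆-trans (step-extensive Y i) (ρ-extensive L (step Y i))

ρ-sound : (L : List (Implication n)) {Y Z : Subset n} → Y ⊆ Z →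
          (∀ imp → imp ∈ₗ L → Respects Z imp) → ρ L Y ⊆ Z
ρ-sound []      Y⊆Z _    = Y⊆Z
ρ-sound (i ∷ L) Y⊆Z resp = ρ-sound L (step-sound i Y⊆Z (resp i (here refl))) (λ imp → resp imp ∘ there)

ρ-fires : {L : List (Implication n)} {Y A B : Subset n} → (A , B) ∈ₗ L → A ⊆ Y → B ⊆ ρ L Y
ρ-fires {L = _ ∷ L} (here refl) A⊆Y = ⊆-trans (step-fires A⊆Y) (ρ-extensive L _)
ρ-fires {L = i ∷ _} (there A⇒B∈L) A⊆Y = ρ-fires A⇒B∈L (⊆-trans A⊆Y (step-extensive _ i))

module Layered {A : Set a} (key : A → ℕ) (U : List A) where

  layer : ℕ → List A
  layer k = filter (λ i → key i ≟ k) U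

  prefix : ℕ → List A
  prefix zero    = []
  prefix (suc k) = prefix k ++ layer k

  ∈-layer⁻ : ∀ k {i} → i ∈ₗ layer k → i ∈ₗ U × key i ≡ k
  ∈-layer⁻ k = ∈-filter⁻ (λ i → key i ≟ k)

  ∈-prefix⁻ : ∀ k {i} → i ∈ₗ prefix k → i ∈ₗ U × key i < k
  ∈-prefix⁻ (suc k) i∈ with ∈-++⁻ (prefix k) i∈
  ... | inj₁ i∈prefix = let (i∈U , i<k) = ∈-prefix⁻ k i∈prefix in i∈U , m≤n⇒m≤1+n i<k
  ... | inj₂ i∈layer  = let (i∈U , i≡k) = ∈-layer⁻ k i∈layer in i∈U , s≤s (≤-reflexive i≡k)

  ∈-prefix⁺ : ∀ k {i} → i ∈ₗ U → key i < k → i ∈ₗ prefix k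
  ∈-prefix⁺ (suc k) {i} i∈U i<1+k with key i ≟ k
  ... | yes i≡k = ∈-++⁺ʳ (prefix k) (∈-filter⁺ (λ i → key i ≟ k) i∈U i≡k)
  ... | no  i≢k = ∈-++⁺ˡ (∈-prefix⁺ k i∈U (≤∧≢⇒< (≤-pred i<1+k) i≢k))

  prefix-unique : Unique U → ∀ k → Unique (prefix k)
  prefix-unique U! zero    = AllPairs.[]
  prefix-unique U! (suc k) =
    Unique.++⁺ (prefix-unique U! k) (Unique.filter⁺ (λ i → key i ≟ k) U!) disjoint
    where
    disjoint : ∀ {i} → ¬ (i ∈ₗ prefix k × i ∈ₗ layer k)
    disjoint (i∈prefix , i∈layer) =
      <-irrefl (proj₂ (∈-layer⁻ k i∈layer)) (proj₂ (∈-prefix⁻ k i∈prefix))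

module _ {Σ' : ImplicationSet n} (Σ? : Decidable Σ') where

  concluded? : (A : Subset n) → Decidable λ i → ∃ λ B → Σ' (A , B) × i ∈ B
  concluded? A i = anySubset? λ B → Σ? (A , B) ×-dec (i ∈? B)

  conclusions : Subset n → Subset n
  conclusions A = fromDec (concluded? A)

  Aggregated? : Decidable (Aggregated Σ')
  Aggregated? (A , B) =
    anySubset? (λ B′ → Σ? (A , B′)) ×-dec all? (λ i → ⇔-dec (i ∈? B) (concluded? A i))

  aggregate-fires : ∀ {A B x} → Σ' (A , B) → x ∈ B → ∃ λ C → Aggregated Σ' (A , C) × x ∈ C
  aggregate-fires {A} {B} ΣAB x∈B =
    conclusions A ,
    ((B , ΣAB) , λ i → mk⇔ (∈-fromDec⁻ (concluded? A)) (∈-fromDec⁺ (concluded? A))) ,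
    ∈-fromDec⁺ (concluded? A) (B , ΣAB , x∈B)

module ClosureSystem {n : ℕ} {φ : Subset n → Subset n} (cl : IsClosureOperator φ) where

  open IsClosureOperator cl

  infix 4 _≪ᵩ_
  _≪ᵩ_ : Subset n → Subset n → Set
  _≪ᵩ_ = _≪_ φ

  ⊆φ⇒φ⊆φ : {A B : Subset n} → A ⊆ φ B → φ A ⊆ φ B
  ⊆φ⇒φ⊆φ {B = B} A⊆φB = subst (_ ∈_) (idempotent B) ∘ monotone A⊆φB

  x∈φ⁅x⁆ : (x : Fin n) → x ∈ φ ⁅ x ⁆
  x∈φ⁅x⁆ x = extensive ⁅ x ⁆ (x∈⁅x⁆ x)

  ∈φ⁅⁆⇒∈φ : {x y : Fin n} {B : Subset n} → x ∈ φ ⁅ y ⁆ → y ∈ B → x ∈ φ B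
  ∈φ⁅⁆⇒∈φ x∈φy y∈B = monotone (x∈p⇒⁅x⁆⊆p y∈B) x∈φy

  ∈φ⁅⁆-trans : {x y z : Fin n} → x ∈ φ ⁅ y ⁆ → y ∈ φ ⁅ z ⁆ → x ∈ φ ⁅ z ⁆
  ∈φ⁅⁆-trans x∈φy y∈φz = ⊆φ⇒φ⊆φ (x∈p⇒⁅x⁆⊆p y∈φz) x∈φy

  ≪-refl : {X : Subset n} → X ≪ᵩ X
  ≪-refl x x∈X = x , x∈X , x∈φ⁅x⁆ x

  ≪-trans : {X Y Z : Subset n} → X ≪ᵩ Y → Y ≪ᵩ Z → X ≪ᵩ Z
  ≪-trans X≪Y Y≪Z x x∈X with X≪Y x x∈X
  ... | y , y∈Y , x∈φy with Y≪Z y y∈Y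
  ...   | z , z∈Z , y∈φz = z , z∈Z , ∈φ⁅⁆-trans x∈φy y∈φz

  ⊆⇒≪ : {X Y : Subset n} → X ⊆ Y → X ≪ᵩ Y
  ⊆⇒≪ X⊆Y x x∈X = x , X⊆Y x∈X , x∈φ⁅x⁆ x

  ≪⇒⊆φ : {X Y : Subset n} → X ≪ᵩ Y → X ⊆ φ Y
  ≪⇒⊆φ X≪Y {x} x∈X with X≪Y x x∈X
  ... | y , y∈Y , x∈φy = ∈φ⁅⁆⇒∈φ x∈φy y∈Y

  ≪? : (X Y : Subset n) → Dec (X ≪ᵩ Y)
  ≪? X Y = all? λ x → (x ∈? X) →-dec any? λ y → (y ∈? Y) ×-dec (x ∈? φ ⁅ y ⁆)

  IsCover? : (X : Subset n) (x : Fin n) → Dec (IsCover φ X x)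
  IsCover? X x = (x ∈? φ X) ×-dec all? λ x′ → (x′ ∈? X) →-dec ¬? (x ∈? φ ⁅ x′ ⁆)

  MinCover? : (x : Fin n) (Y : Subset n) → Dec (MinCover φ x Y)
  MinCover? x Y = IsCover? Y x ×-dec ∀-subset? λ Z → IsCover? Z x →-dec ≪? Z Y →-dec Y ⊆? Z

  MinCover*? : (x : Fin n) (Y : Subset n) → Dec (MinCover* φ x Y)
  MinCover*? x Y = MinCover? x Y ×-dec ∀-subset? λ Z → MinCover? x Z →-dec φ Z ⊆? φ Y →-dec φ Y ⊆? φ Z

  D? : (x y : Fin n) → Dec (D φ x y)
  D? x y = anySubset? λ Y → MinCover? x Y ×-dec (y ∈? Y)

  SigmaE? : Decidable (SigmaE φ)
  SigmaE? (A , B) =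
    any? (λ y → any? λ x → (A ≟ˢ ⁅ y ⁆) ×-dec (B ≟ˢ ⁅ x ⁆) ×-dec (x ∈? φ ⁅ y ⁆) ×-dec ¬? (x ≟ᶠ y))
      ⊎-dec any? λ x → (B ≟ˢ ⁅ x ⁆) ×-dec MinCover*? x A

  Sound : ImplicationSet n → Set
  Sound Σ' = ∀ {A B} → Σ' (A , B) → B ⊆ φ A

  SigmaE-sound : Sound (SigmaE φ)
  SigmaE-sound (inj₁ (_ , _ , refl , refl , x∈φy , _)) = x∈p⇒⁅x⁆⊆p x∈φy
  SigmaE-sound (inj₂ (_ , refl , ((x∈φA , _) , _) , _)) = x∈p⇒⁅x⁆⊆p x∈φA

  Aggregated-sound : {Σ' : ImplicationSet n} → Sound Σ' → Sound (Aggregated Σ')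
  Aggregated-sound sound (_ , B⇔) i∈B with Equivalence.to (B⇔ _) i∈B
  ... | _ , ΣAB′ , i∈B′ = sound ΣAB′ i∈B′

  sound⇒respects-φ : {Σ' : ImplicationSet n} → Sound Σ' → ∀ X {imp} → Σ' imp → Respects (φ X) imp
  sound⇒respects-φ sound X ΣAB A⊆φX = ⊆-trans (sound ΣAB) (⊆φ⇒φ⊆φ A⊆φX)

  ordered-direct⇒basis : {Σ' : ImplicationSet n} → Sound Σ' → OrderedDirect φ Σ' → IsBasis φ Σ'
  ordered-direct⇒basis sound (L , (_ , L⇔Σ) , ρL≡φ) X =
    extensive X ,
    (λ _ → sound⇒respects-φ sound X) ,
    λ Z X⊆Z respects → subst (_⊆ Z) (ρL≡φ X)
      (ρ-sound L X⊆Z λ imp imp∈L → respects imp (Equivalence.to (L⇔Σ imp) imp∈L))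

  below? : (Y : Subset n) → Decidable λ a → ∃ λ y → y ∈ Y × a ∈ φ ⁅ y ⁆
  below? Y a = any? λ y → (y ∈? Y) ×-dec (a ∈? φ ⁅ y ⁆)

  down : Subset n → Subset n
  down Y = fromDec (below? Y)

  ∈-down⁺ : {Y : Subset n} {a y : Fin n} → y ∈ Y → a ∈ φ ⁅ y ⁆ → a ∈ down Y
  ∈-down⁺ {Y} y∈Y a∈φy = ∈-fromDec⁺ (below? Y) (_ , y∈Y , a∈φy)

  ∈-down⁻ : {Y : Subset n} {a : Fin n} → a ∈ down Y → ∃ λ y → y ∈ Y × a ∈ φ ⁅ y ⁆
  ∈-down⁻ {Y} = ∈-fromDec⁻ (below? Y)

  down-mono : {Y Z : Subset n} → Z ≪ᵩ Y → down Z ⊆ down Y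
  down-mono Z≪Y a∈↓Z with ∈-down⁻ a∈↓Z
  ... | z , z∈Z , a∈φz with Z≪Y z z∈Z
  ...   | y , y∈Y , z∈φy = ∈-down⁺ y∈Y (∈φ⁅⁆-trans a∈φz z∈φy)

  cover-≪ : {Y W : Subset n} {x : Fin n} → IsCover φ Y x → W ⊆ Y → Y ≪ᵩ W → IsCover φ W x
  cover-≪ (x∈φY , x∉φY) W⊆Y Y≪W = ⊆φ⇒φ⊆φ (≪⇒⊆φ Y≪W) x∈φY , λ x′ x′∈W → x∉φY x′ (W⊆Y x′∈W)

  ≪-remove : {Y : Subset n} {a y : Fin n} → y ∈ Y → y ≢ a → a ∈ φ ⁅ y ⁆ → Y ≪ᵩ Y - a
  ≪-remove {a = a} y∈Y y≢a a∈φy b b∈Y with b ≟ᶠ a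
  ... | yes refl = _ , x∈p∧x≢y⇒x∈p-y y∈Y y≢a , a∈φy
  ... | no b≢a   = b , x∈p∧x≢y⇒x∈p-y b∈Y b≢a , x∈φ⁅x⁆ b

  D-irrefl : (x : Fin n) → ¬ D φ x x
  D-irrefl x (_ , ((_ , x∉φY) , _) , x∈Y) = x∉φY x x∈Y (x∈φ⁅x⁆ x)

  -- Minimal covers

  module MinimalCovers (red : Reduced φ) where

    ∈φ⁅⁆-antisym : {a b : Fin n} → a ∈ φ ⁅ b ⁆ → b ∈ φ ⁅ a ⁆ → a ≡ b
    ∈φ⁅⁆-antisym a∈φb b∈φa =
      red _ _ (⊆-antisym (⊆φ⇒φ⊆φ (x∈p⇒⁅x⁆⊆p a∈φb)) (⊆φ⇒φ⊆φ (x∈p⇒⁅x⁆⊆p b∈φa)))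

    module _ (x : Fin n) where

      _⊏_ : Rel (Subset n) _
      Z ⊏ Y = ×-Lex _≡_ _<_ _<_ (∣ down Z ∣ , ∣ Z ∣) (∣ down Y ∣ , ∣ Y ∣)

      open Descent _⊏_ _≪ᵩ_ (λ Y → IsCover φ Y x)
        renaming (Improvable to ImprovableCover; descend to descendCover)
      open Descent (λ Z Y → φ Z ⊂ φ Y) (λ Z Y → φ Z ⊆ φ Y) (MinCover φ x)
        renaming (Improvable to ImprovableMinCover; descend to descendMinCover)

      -- Either a ∉ down Z, and then down Z ⊂ down Y, or a ∈ φ(y) for some y ∈ Y with y ≠ a (y = a
      -- would give φ(a) = φ(z) for some z ∈ Z), and then Y - a covers x with the same down-set.
      improve : {Y Z : Subset n} {a : Fin n} → IsCover φ Y x → IsCover φ Z x → Z ≪ᵩ Y →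
                a ∈ Y → a ∉ Z → ImprovableCover Y
      improve {Y} {Z} {a} covY covZ Z≪Y a∈Y a∉Z with a ∈? down Z
      ... | no a∉↓Z =
        Z , covZ , Z≪Y , inj₁ (p⊂q⇒∣p∣<∣q∣ (down-mono Z≪Y , a , ∈-down⁺ a∈Y (x∈φ⁅x⁆ a) , a∉↓Z))
      ... | yes a∈↓Z with ∈-down⁻ a∈↓Z
      ...   | z , z∈Z , a∈φz with Z≪Y z z∈Z
      ...     | y , y∈Y , z∈φy with y ≟ᶠ a
      ...       | yes refl = ⊥-elim (a∉Z (subst (_∈ Z) (∈φ⁅⁆-antisym z∈φy a∈φz) z∈Z))
      ...       | no y≢a   =
        Y - a , cover-≪ covY Y-a⊆Y Y≪Y-a , ⊆⇒≪ Y-a⊆Y , inj₂ (same-down , x∈p⇒∣p-x∣<∣p∣ a∈Y)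
        where
        Y-a⊆Y : Y - a ⊆ Y
        Y-a⊆Y = p─q⊆p Y ⁅ a ⁆
        Y≪Y-a : Y ≪ᵩ Y - a
        Y≪Y-a = ≪-remove y∈Y y≢a (∈φ⁅⁆-trans a∈φz z∈φy)
        same-down : ∣ down (Y - a) ∣ ≡ ∣ down Y ∣
        same-down = cong ∣_∣ (⊆-antisym (down-mono (⊆⇒≪ Y-a⊆Y)) (down-mono Y≪Y-a))

      unimprovable⇒minimal : {Y : Subset n} → IsCover φ Y x → ¬ ImprovableCover Y → MinCover φ x Y
      unimprovable⇒minimal covY unimprovable = covY , λ Z covZ Z≪Y {a} a∈Y →
        decidable-stable (a ∈? Z) (unimprovable ∘ improve covY covZ Z≪Y a∈Y)

      unimprovable⇒minimal* : {Y : Subset n} → MinCover φ x Y → ¬ ImprovableMinCover Y → MinCover* φ x Y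
      unimprovable⇒minimal* minY unimprovable = minY , λ Z minZ φZ⊆φY {a} a∈φY →
        decidable-stable (a ∈? φ Z) λ a∉φZ → unimprovable (Z , minZ , φZ⊆φY , φZ⊆φY , a , a∈φY , a∉φZ)

      ⊏-wellFounded : WellFounded _⊏_
      ⊏-wellFounded = On.wellFounded _ (×-wellFounded <-wellFounded <-wellFounded)

      improvableCover? : Decidable ImprovableCover
      improvableCover? Y = anySubset? λ Z → IsCover? Z x ×-dec ≪? Z Y ×-dec
        ×-decidable _≟_ _<?_ _<?_ (∣ down Z ∣ , ∣ Z ∣) (∣ down Y ∣ , ∣ Y ∣)

      improvableMinCover? : Decidable ImprovableMinCover
      improvableMinCover? Y = anySubset? λ Z → MinCover? x Z ×-dec φ Z ⊆? φ Y ×-dec φ Z ⊂? φ Y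

      minimalCover-≪ : {X : Subset n} → IsCover φ X x → ∃ λ Y → MinCover φ x Y × Y ≪ᵩ X
      minimalCover-≪ covX with descendCover ⊏-wellFounded ≪-refl ≪-trans improvableCover? covX
      ... | Y , covY , Y≪X , unimprovable = Y , unimprovable⇒minimal covY unimprovable , Y≪X

      minimalCover* : {X : Subset n} → IsCover φ X x → ∃ λ Y → MinCover* φ x Y × Y ⊆ φ X
      minimalCover* covX with minimalCover-≪ covX
      ... | Y₀ , minY₀ , Y₀≪X
          with descendMinCover (On.wellFounded φ ⊂-wellFounded) (λ p → p) (λ p q → q ∘ p)
                             improvableMinCover? minY₀
      ...   | Y , minY , φY⊆φY₀ , unimprovable =
        Y , unimprovable⇒minimal* minY unimprovable , ⊆φ⇒φ⊆φ (≪⇒⊆φ Y₀≪X) ∘ φY⊆φY₀ ∘ extensive Y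

  -- Heights

  module Rank (acyclic : WithoutDCycles φ) where

    D⁺-irrefl : {x : Fin n} → ¬ TransClosure (D φ) x x
    D⁺-irrefl [ xDx ] = D-irrefl _ xDx
    D⁺-irrefl {x} (xDy ∷ y⁺x) with TransClosure⇒Walk y⁺x
    ... | m , xs , xs₀≡y , xsₘ≡x , steps = acyclic (m , cycle , cycle-steps , cycle-closes)
      where
      cycle : Fin (suc (suc m)) → Fin n
      cycle zero    = x
      cycle (suc i) = xs (inject₁ i)
      cycle-steps : ∀ i → D φ (cycle (inject₁ i)) (cycle (suc i))
      cycle-steps zero    = subst (D φ x) (sym xs₀≡y) xDy
      cycle-steps (suc i) = steps (inject₁ i)
      cycle-closes : D φ (cycle (fromℕ (suc m))) (cycle zero)
      cycle-closes = subst (D φ _) xsₘ≡x (steps (fromℕ m))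

    D⁺-isStrictPartialOrder : IsStrictPartialOrder _≡_ (TransClosure (D φ))
    D⁺-isStrictPartialOrder = record
      { isEquivalence = isEquivalence
      ; irrefl        = λ { refl → D⁺-irrefl }
      ; trans         = transitive _
      ; <-resp-≈      = resp₂ _
      }

    _◁_ : Rel (Fin n) _
    y ◁ x = D φ x y

    ◁-wellFounded : WellFounded _◁_
    ◁-wellFounded = Subrelation.wellFounded [_] (spo-noetherian D⁺-isStrictPartialOrder)

    height : {x : Fin n} → Acc _◁_ x → ℕ
    height {x} (acc rs) = maxᶠ λ y → onYes (D? x y) λ xDy → suc (height (rs xDy))

    height-irrelevant : {x : Fin n} (p q : Acc _◁_ x) → height p ≡ height q
    height-irrelevant {x} (acc rs) (acc rs′) =
      maxᶠ-cong λ y → onYes-cong (D? x y) λ xDy → cong suc (height-irrelevant (rs xDy) (rs′ xDy))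

    height-D : {x y : Fin n} (p : Acc _◁_ x) (q : Acc _◁_ y) → D φ x y → suc (height q) ≤ height p
    height-D {x} {y} (acc rs) q xDy = ≤-trans
      (≤-onYes (D? x y) xDy λ xDy′ → s≤s (≤-reflexive (height-irrelevant q (rs xDy′))))
      (≤-maxᶠ _ y)

    H : Fin n → ℕ
    H x = height (◁-wellFounded x)

    H-D : {x y : Fin n} → D φ x y → H y < H x
    H-D {x} {y} = height-D (◁-wellFounded x) (◁-wellFounded y)

  -- Ordered directness

  module Direct (red : Reduced φ) (acyclic : WithoutDCycles φ) where

    open MinimalCovers red using (minimalCover*)
    open Rank acyclic

    premiseHeight : Subset n → ℕ
    premiseHeight A = maxᶠ λ y → onYes (y ∈? A) λ _ → suc (H y)

    premiseHeight-≥ : {y : Fin n} {A : Subset n} → y ∈ A → suc (H y) ≤ premiseHeight A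
    premiseHeight-≥ {y} {A} y∈A = ≤-trans (≤-onYes (y ∈? A) y∈A λ _ → ≤-refl) (≤-maxᶠ _ y)

    premiseHeight-≤ : {A : Subset n} {c : ℕ} → (∀ y → y ∈ A → suc (H y) ≤ c) → premiseHeight A ≤ c
    premiseHeight-≤ {A} bound = maxᶠ-≤ λ y → onYes-≤ (y ∈? A) (bound y)

    key : Subset n → ℕ
    key A with any? (λ y → A ≟ˢ ⁅ y ⁆)
    ... | yes _ = 0
    ... | no _  = suc (premiseHeight A)

    key-⁅⁆ : (y : Fin n) → key ⁅ y ⁆ ≡ 0
    key-⁅⁆ y with any? (λ z → ⁅ y ⁆ ≟ˢ ⁅ z ⁆)
    ... | yes _         = refl
    ... | no ¬singleton = ⊥-elim (¬singleton (y , refl))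

    key-cover : {A : Subset n} {x : Fin n} → IsCover φ A x → key A ≡ suc (premiseHeight A)
    key-cover {A} (x∈φA , x∉φA) with any? (λ y → A ≟ˢ ⁅ y ⁆)
    ... | no _           = refl
    ... | yes (y , refl) = ⊥-elim (x∉φA y (x∈⁅x⁆ y) x∈φA)

    depth : ℕ
    depth = 3 + maxᶠ H

    key<depth : (A : Subset n) → key A < depth
    key<depth A with any? (λ y → A ≟ˢ ⁅ y ⁆)
    ... | yes _ = s≤s z≤n
    ... | no _  = s≤s (s≤s (premiseHeight-≤ λ y _ → s≤s (≤-maxᶠ H y)))

    module OrderedDirectness
      {Σ' : ImplicationSet n} (Σ? : Decidable Σ') (sound : Sound Σ')
      (fires-point : ∀ {x y} → x ∈ φ ⁅ y ⁆ → x ≢ y → ∃ λ B → Σ' (⁅ y ⁆ , B) × x ∈ B)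
      (fires-cover : ∀ {x A} → MinCover* φ x A → ∃ λ B → Σ' (A , B) × x ∈ B)
      where

      U : List (Implication n)
      U = filter Σ? (allImplications n)

      open Layered (key ∘ proj₁) U

      ∈-U⁺ : ∀ {imp} → Σ' imp → imp ∈ₗ U
      ∈-U⁺ {imp} = ∈-filter⁺ Σ? (∈-allImplications imp)

      ∈-U⁻ : ∀ {imp} → imp ∈ₗ U → Σ' imp
      ∈-U⁻ = proj₂ ∘ ∈-filter⁻ Σ? {xs = allImplications n}

      module Stages (X : Subset n) where

        stage : ℕ → Subset n
        stage k = ρ (prefix k) X

        stage-suc : ∀ k → stage (suc k) ≡ ρ (layer k) (stage k)
        stage-suc k = foldl-++ step X (prefix k) (layer k)

        stage-grows : ∀ k → stage k ⊆ stage (suc k)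
        stage-grows k = subst (stage k ⊆_) (sym (stage-suc k)) (ρ-extensive (layer k) (stage k))

        stage-mono′ : ∀ {j k} → j ≤′ k → stage j ⊆ stage k
        stage-mono′ ≤′-refl         = λ x∈ → x∈
        stage-mono′ (≤′-step {k} j≤′k) = ⊆-trans (stage-mono′ j≤′k) (stage-grows k)

        stage-mono : ∀ {j k} → j ≤ k → stage j ⊆ stage k
        stage-mono = stage-mono′ ∘ ≤⇒≤′

        stage-fires : ∀ {A B k} → Σ' (A , B) → key A ≡ k → A ⊆ stage k → B ⊆ stage (suc k)
        stage-fires {k = k} ΣAB keyA≡k A⊆stage = subst (_ ⊆_) (sym (stage-suc k))
          (ρ-fires (∈-filter⁺ (λ i → key (proj₁ i) ≟ k) (∈-U⁺ ΣAB) keyA≡k) A⊆stage)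

        point-in-stage₁ : ∀ {x y} → y ∈ X → x ∈ φ ⁅ y ⁆ → x ∈ stage 1
        point-in-stage₁ {x} {y} y∈X x∈φy with x ≟ᶠ y
        ... | yes refl = ρ-extensive (prefix 1) X y∈X
        ... | no x≢y with fires-point x∈φy x≢y
        ...   | B , ΣyB , x∈B = stage-fires ΣyB (key-⁅⁆ y) (x∈p⇒⁅x⁆⊆p y∈X) x∈B

        φ-in-stage : ∀ {x} → Acc _◁_ x → x ∈ φ X → x ∈ stage (2 + H x)
        φ-in-stage {x} (acc rs) x∈φX with any? (λ y → (y ∈? X) ×-dec (x ∈? φ ⁅ y ⁆))
        ... | yes (y , y∈X , x∈φy) = stage-mono {1} {2 + H x} (s≤s z≤n) (point-in-stage₁ y∈X x∈φy)
        ... | no ¬below with minimalCover* x {X} (x∈φX , (λ y y∈X x∈φy → ¬below (y , y∈X , x∈φy)))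
        ...   | Y , Y∈M* , Y⊆φX with fires-cover Y∈M*
        ...     | B , ΣYB , x∈B =
          stage-mono {2 + premiseHeight Y} (s≤s (s≤s premiseHeightY≤Hx))
            (stage-fires ΣYB (key-cover (proj₁ (proj₁ Y∈M*))) Y⊆stage x∈B)
          where
          premiseHeightY≤Hx : premiseHeight Y ≤ H x
          premiseHeightY≤Hx = premiseHeight-≤ λ y y∈Y → H-D (Y , proj₁ Y∈M* , y∈Y)
          Y⊆stage : Y ⊆ stage (suc (premiseHeight Y))
          Y⊆stage {y} y∈Y = stage-mono {2 + H y} (s≤s (premiseHeight-≥ y∈Y))
            (φ-in-stage (rs (Y , proj₁ Y∈M* , y∈Y)) (Y⊆φX y∈Y))

        ρ-prefix≡φ : ρ (prefix depth) X ≡ φ X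
        ρ-prefix≡φ = ⊆-antisym
          (ρ-sound (prefix depth) (extensive X)
            λ imp imp∈ → sound⇒respects-φ sound X (∈-U⁻ (proj₁ (∈-prefix⁻ depth imp∈))))
          λ {x} x∈φX → stage-mono {2 + H x} (s≤s (s≤s (m≤n⇒m≤1+n (≤-maxᶠ H x))))
            (φ-in-stage (◁-wellFounded x) x∈φX)

      ordered-direct : OrderedDirect φ Σ'
      ordered-direct =
        prefix depth ,
        ( prefix-unique (Unique.filter⁺ Σ? (allImplications-unique n)) depth
        , λ imp → mk⇔ (∈-U⁻ ∘ proj₁ ∘ ∈-prefix⁻ depth)
                      λ Σimp → ∈-prefix⁺ depth (∈-U⁺ Σimp) (key<depth _)) ,
        Stages.ρ-prefix≡φ

    open OrderedDirectness using (ordered-direct)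

    SigmaE-ordered-direct : OrderedDirect φ (SigmaE φ)
    SigmaE-ordered-direct = ordered-direct SigmaE? SigmaE-sound
      (λ x∈φy x≢y → _ , inj₁ (_ , _ , refl , refl , x∈φy , x≢y) , x∈⁅x⁆ _)
      (λ A∈M* → _ , inj₂ (_ , refl , A∈M*) , x∈⁅x⁆ _)

    Aggregated-SigmaE-ordered-direct : OrderedDirect φ (Aggregated (SigmaE φ))
    Aggregated-SigmaE-ordered-direct =
      ordered-direct (Aggregated? SigmaE?) (Aggregated-sound SigmaE-sound)
      (λ x∈φy x≢y → aggregate-fires SigmaE? (inj₁ (_ , _ , refl , refl , x∈φy , x≢y)) (x∈⁅x⁆ _))
      (λ A∈M* → aggregate-fires SigmaE? (inj₂ (_ , refl , A∈M*)) (x∈⁅x⁆ _))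

theorem21 : (m : ℕ) (φ : Subset (suc m) → Subset (suc m)) →
    IsClosureOperator φ → Reduced φ → WithoutDCycles φ →
    IsBasis φ (SigmaE φ) × OrderedDirect φ (SigmaE φ) × OrderedDirect φ (Aggregated (SigmaE φ))
theorem21 _ _ cl red acyclic =
  ordered-direct⇒basis SigmaE-sound SigmaE-ordered-direct ,
  SigmaE-ordered-direct ,
  Aggregated-SigmaE-ordered-direct
  where
  open ClosureSystem cl
  open Direct red acyclic
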